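{- For every oriented forest $F$, $\mathrm{mad}_{\vec{\chi}}(F)=|V(F)|$.
   Context: An oriented forest is an orientation of an undirected forest. $\vec{\chi}(D)$ is the least $k$ such that $V(D)$ can be partitioned into $k$ sets each inducing an acyclic subdigraph. A subdivision of $F$ is obtained by replacing each arc $(u,v)$ by a directed $(u,v)$-path of length at least 1, internally disjoint; $D$ contains a subdivision of $F$ if some subdigraph of $D$ is one. $\mathrm{mad}_{\vec{\chi}}(F)$ is the least integer $c$ such that every digraph $D$ with $\vec{\chi}(D)\ge c$ contains a subdivision of $F$. -}

module Defs where

open import Data.Nat using (ℕ; zero; suc; _≤_)
open import Data.Fin using (Fin; zero; suc; inject₁; fromℕ)
open import Data.Bool using (Bool; true; false; _∨_)
open import Data.Product using (Σ; _×_; _,_; ∃)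
open import Relation.Binary.PropositionalEquality using (_≡_; _≢_)
open import Relation.Nullary using (¬_)
open import Function.Definitions using (Injective)

-- Finite digraphs: vertex set Fin size, arc relation given by a
-- Bool-valued adjacency; loopless (digons allowed, no parallel arcs).

record Digraph : Set where
  field
    size     : ℕ
    arc      : Fin size → Fin size → Bool
    loopless : ∀ v → arc v v ≡ false

open Digraph public

Vtx : Digraph → Set
Vtx D = Fin (size D)

Arc : (D : Digraph) → Vtx D → Vtx D → Set
Arc D u v = arc D u v ≡ true

record DirCycle (D : Digraph) : Set where
  field
    len   : ℕ
    cyc   : Fin (suc len) → Vtx D
    inj   : Injective _≡_ _≡_ cyc
    steps : ∀ (i : Fin len) → Arc D (cyc (inject₁ i)) (cyc (suc i))
    close : Arc D (cyc (fromℕ len)) (cyc zero)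

open DirCycle public

InducesAcyclic : (D : Digraph) → (Vtx D → Set) → Set
InducesAcyclic D S = (C : DirCycle D) → ¬ (∀ i → S (cyc C i))

Dicolourable : Digraph → ℕ → Set
Dicolourable D k =
  Σ (Vtx D → Fin k) λ f → ∀ (j : Fin k) → InducesAcyclic D (λ v → f v ≡ j)

-- χ⃗(D) ≥ c : every k admitting such a partition satisfies c ≤ k.
-- (χ⃗(D) is the least such k, which exists since k = |V(D)| works.)
DichromaticAtLeast : Digraph → ℕ → Set
DichromaticAtLeast D c = ∀ k → Dicolourable D k → c ≤ k

UAdj : (D : Digraph) → Vtx D → Vtx D → Set
UAdj D u v = (arc D u v ∨ arc D v u) ≡ true

record UndirCycle (D : Digraph) : Set where
  field
    len   : ℕ
    cyc   : Fin (suc (suc (suc len))) → Vtx D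
    inj   : Injective _≡_ _≡_ cyc
    steps : ∀ (i : Fin (suc (suc len))) → UAdj D (cyc (inject₁ i)) (cyc (suc i))
    close : UAdj D (cyc (fromℕ (suc (suc len)))) (cyc zero)

record OrientedForest : Set where
  field
    graph    : Digraph
    noDigon  : ∀ u v → Arc graph u v → arc graph v u ≡ false
    acyclicU : ¬ UndirCycle graph

open OrientedForest public

-- Directed paths of length ≥ 1 from x to y: an injective sequence
-- p₀ = x, p₁, …, p_{k+1} = y with consecutive arcs.  The internal
-- vertices are p₁ … p_k, i.e. p (suc (inject₁ j)) for j : Fin k.

record DirPath (D : Digraph) (x y : Vtx D) : Set where
  field
    nInt  : ℕ
    pth   : Fin (suc (suc nInt)) → Vtx D
    inj   : Injective _≡_ _≡_ pth
    start : pth zero ≡ x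
    end   : pth (fromℕ (suc nInt)) ≡ y
    steps : ∀ (i : Fin (suc nInt)) → Arc D (pth (inject₁ i)) (pth (suc i))

open DirPath public

internal : ∀ {D x y} (P : DirPath D x y) → Fin (nInt P) → Vtx D
internal P j = pth P (suc (inject₁ j))

record ContainsSubdivision (D : Digraph) (F : Digraph) : Set where
  field
    φ       : Vtx F → Vtx D
    φ-inj   : Injective _≡_ _≡_ φ
    path    : ∀ u v → Arc F u v → DirPath D (φ u) (φ v)
    avoidφ  : ∀ u v (a : Arc F u v) (j : Fin (nInt (path u v a))) (w : Vtx F) →
              internal (path u v a) j ≢ φ w
    disjoint : ∀ u v (a : Arc F u v) u' v' (a' : Arc F u' v') →
               (u , v) ≢ (u' , v') →
               ∀ (j : Fin (nInt (path u v a))) (j' : Fin (nInt (path u' v' a'))) →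
               internal (path u v a) j ≢ internal (path u' v' a') j'

ForcesSubdivision : Digraph → ℕ → Set
ForcesSubdivision F c = ∀ (D : Digraph) → DichromaticAtLeast D c → ContainsSubdivision D F

MadChi≡ : Digraph → ℕ → Set
MadChi≡ F c = ForcesSubdivision F c × (∀ c' → ForcesSubdivision F c' → c ≤ c')

{-# OPTIONS --safe #-}
-- Lower bound: the complete symmetric digraph on c vertices has dichromatic number c, and a
-- subdivision of F inside it places the vertices of F injectively.
-- Upper bound: if D is not m-dicolourable, greedy colouring gets stuck on a nonempty set R in
-- which every vertex has at least m in- and m out-neighbours. Indeed a vertex v with fewer than m
-- in- (or out-) neighbours in R can be deleted, the rest coloured, and v given a colour missing
-- among those neighbours, because every directed cycle through v passes through one of them.
-- An oriented forest on m + 1 vertices embeds into such an R as a subdigraph: remove a leaf ℓ,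
-- embed the rest, and send ℓ to an unused out- (or in-) neighbour of the image of its neighbour;
-- there are m candidates and at most m - 1 other vertices in use. Leaves exist because a path
-- grown at a non-leaf head would otherwise close an undirected cycle.
module Submission where

open import Defs
open import Data.Bool using (Bool; true; false; _∨_; not)
open import Data.Bool.Properties using (∨-comm) renaming (_≟_ to _≟ᵇ_)
open import Data.Empty using (⊥-elim)
open import Data.Fin using (Fin; zero; suc; inject₁; inject≤; fromℕ; toℕ; _≟_)
open import Data.Fin.Properties
  using (any?; injective⇒≤; inject≤-injective; pigeonhole; <⇒≢; ¬Fin0;
         toℕ-injective; toℕ-inject≤; toℕ-inject₁; toℕ-fromℕ; toℕ<n)
open import Data.Fin.Subset using (Subset; _⊂_; inside; outside; _∈_; _∉_; _-_; _∩_; ∣_∣; Nonempty; ⊤)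
open import Data.Fin.Subset.Properties
  using (nonempty?; Empty-unique; ∣⊥∣≡0; ∣⊤∣≡n; ∈⊤; p─⊥≡p; p─q⊆p; x∈p∧x≢y⇒x∈p-y; x∈p⇒p-x⊂p;
         x∈p⇒∣p-x∣<∣p∣; ∣p─q∣≤∣p∣; p⊂q⇒∣p∣<∣q∣; p∩q⊆p; x∈p∩q⁺; x∈p∩q⁻; _∈?_)
open import Data.Fin.Subset.Induction using (Acc; acc; ⊂-wellFounded)
open import Data.Nat using (ℕ; zero; suc; _≤_; _<_; _+_; s≤s; s≤s⁻¹; z≤n; _<?_)
open import Data.Nat.Properties
  using (≤-refl; ≤-trans; <-≤-trans; ≤-<-trans; <-irrefl; n≤1+n; 1+n≰n; <⇒≱; ≮⇒≥; +-suc; +-identityʳ)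
open import Data.Product using (Σ; ∃; ∃₂; _×_; _,_; proj₂)
open import Data.Sum using (_⊎_; inj₁; inj₂)
open import Data.Vec using (_∷_; []; tabulate; lookup; here; there)
open import Data.Vec.Properties using (lookup∘tabulate; []=⇒lookup; lookup⇒[]=)
open import Data.Vec.Functional as Vector using (updateAt)
open import Data.Vec.Functional.Properties using (updateAt-updates; updateAt-minimal)
open import Function using (_∘_)
open import Function.Definitions using (Injective)
open import Relation.Binary.PropositionalEquality
open import Relation.Nullary using (¬_; Dec; yes; no; does; contradiction)
open import Relation.Nullary.Decidable
  using (_×-dec_; _⊎-dec_; ¬?; dec-true; dec-false; decidable-stable)

private
  variable
    n : ℕ
    p q : Subset n
    x y : Fin n

y∉p-y : ∀ (p : Subset n) y → y ∉ p - y
y∉p-y (_ ∷ p) (suc y) (there y∈p-y) = y∉p-y p y y∈p-y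

x∈p-y⇒x≢y : x ∈ p - y → x ≢ y
x∈p-y⇒x≢y {p = p} x∈p-x refl = y∉p-y p _ x∈p-x

∣p∣≤1+∣p-x∣ : ∀ (p : Subset n) x → ∣ p ∣ ≤ suc ∣ p - x ∣
∣p∣≤1+∣p-x∣ (outside ∷ p) zero    = subst (λ r → ∣ p ∣ ≤ suc ∣ r ∣) (sym (p─⊥≡p p)) (n≤1+n _)
∣p∣≤1+∣p-x∣ (inside  ∷ p) zero    = subst (λ r → suc ∣ p ∣ ≤ suc ∣ r ∣) (sym (p─⊥≡p p)) ≤-refl
∣p∣≤1+∣p-x∣ (outside ∷ p) (suc x) = ∣p∣≤1+∣p-x∣ p x
∣p∣≤1+∣p-x∣ (inside  ∷ p) (suc x) = s≤s (∣p∣≤1+∣p-x∣ p x)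

0<∣p∣⇒Nonempty : 0 < ∣ p ∣ → Nonempty p
0<∣p∣⇒Nonempty {n} {p} 0<∣p∣ with nonempty? p
... | yes ne   = ne
... | no empty = contradiction (subst (λ r → 0 < ∣ r ∣) (Empty-unique empty) 0<∣p∣)
                               (λ 0<∣⊥∣ → <-irrefl (sym (∣⊥∣≡0 n)) 0<∣⊥∣)

∣p∣<∣q∣⇒∃∉image : ∀ {m} (f : Fin m → Fin n) (p : Subset m) {q : Subset n} → ∣ p ∣ < ∣ q ∣ →
                  ∃ λ x → x ∈ q × ∀ {w} → w ∈ p → f w ≢ x
∣p∣<∣q∣⇒∃∉image f [] 0<∣q∣ with 0<∣p∣⇒Nonempty 0<∣q∣
... | x , x∈q = x , x∈q , λ ()
∣p∣<∣q∣⇒∃∉image f (outside ∷ p) ∣p∣<∣q∣ with ∣p∣<∣q∣⇒∃∉image (f ∘ suc) p ∣p∣<∣q∣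
... | x , x∈q , unhit = x , x∈q , λ { (there w∈p) → unhit w∈p }
∣p∣<∣q∣⇒∃∉image f (inside ∷ p) {q} ∣p∣<∣q∣
  with ∣p∣<∣q∣⇒∃∉image (f ∘ suc) p {q = q - f zero} (s≤s⁻¹ (≤-trans ∣p∣<∣q∣ (∣p∣≤1+∣p-x∣ q (f zero))))
... | x , x∈q-f0 , unhit = x , p─q⊆p q _ x∈q-f0 ,
      λ { here → λ f0≡x → x∈p-y⇒x≢y x∈q-f0 (sym f0≡x) ; (there w∈p) → unhit w∈p }

∈-tabulate⁺ : ∀ {f : Fin n → Bool} → f x ≡ true → x ∈ tabulate f
∈-tabulate⁺ {x = x} {f} fx≡true = lookup⇒[]= x (tabulate f) (trans (lookup∘tabulate f x) fx≡true)

∈-tabulate⁻ : ∀ {f : Fin n → Bool} → x ∈ tabulate f → f x ≡ true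
∈-tabulate⁻ {x = x} {f} x∈f = trans (sym (lookup∘tabulate f x)) ([]=⇒lookup x∈f)

inject₁-or-fromℕ : ∀ (i : Fin (suc n)) → (∃ λ j → i ≡ inject₁ j) ⊎ i ≡ fromℕ n
inject₁-or-fromℕ {zero}  zero    = inj₂ refl
inject₁-or-fromℕ {suc n} zero    = inj₁ (zero , refl)
inject₁-or-fromℕ {suc n} (suc i) with inject₁-or-fromℕ i
... | inj₁ (j , refl) = inj₁ (suc j , refl)
... | inj₂ refl       = inj₂ refl

pair-injective : ∀ {A : Set} {u v : A} → u ≢ v → Injective _≡_ _≡_ (lookup (u ∷ v ∷ []))
pair-injective u≢v {zero}     {zero}     _   = refl
pair-injective u≢v {zero}     {suc zero} u≡v = contradiction u≡v u≢v
pair-injective u≢v {suc zero} {zero}     v≡u = contradiction (sym v≡u) u≢v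
pair-injective u≢v {suc zero} {suc zero} _   = refl

module _ (D : Digraph) where

  out-nbhd in-nbhd : Vtx D → Subset (size D)
  out-nbhd v = tabulate (arc D v)
  in-nbhd  v = tabulate (λ u → arc D u v)

  Arc⇒≢ : ∀ {u v} → Arc D u v → u ≢ v
  Arc⇒≢ {u} uu refl with trans (sym uu) (loopless D u)
  ... | ()

  Arc⇒UAdj : ∀ {u v} → Arc D u v → UAdj D u v
  Arc⇒UAdj uv rewrite uv = refl

  UAdj-sym : ∀ {u v} → UAdj D u v → UAdj D v u
  UAdj-sym {u} {v} uv = trans (∨-comm (arc D v u) (arc D u v)) uv

  UAdj-irrefl : ∀ {v} → ¬ UAdj D v v
  UAdj-irrefl {v} vv rewrite loopless D v with vv
  ... | ()

  UAdj? : ∀ u v → Dec (UAdj D u v)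
  UAdj? u v = (arc D u v ∨ arc D v u) ≟ᵇ true

  UAdj⇒Arc⊎Arc˘ : ∀ {u v} → UAdj D u v → Arc D u v ⊎ Arc D v u
  UAdj⇒Arc⊎Arc˘ {u} {v} uv with arc D u v
  ... | true  = inj₁ refl
  ... | false = inj₂ uv

  predecessor : (C : DirCycle D) (i : Fin (suc (len C))) → ∃ λ j → Arc D (cyc C j) (cyc C i)
  predecessor C zero    = fromℕ (len C) , close C
  predecessor C (suc i) = inject₁ i , steps C i

  successor : (C : DirCycle D) (i : Fin (suc (len C))) → ∃ λ j → Arc D (cyc C i) (cyc C j)
  successor C i with inject₁-or-fromℕ i
  ... | inj₁ (j , refl) = suc j , steps C j
  ... | inj₂ refl       = zero , close C

  ∈R∩in-nbhd⁺ : ∀ {R u v} → u ∈ R → Arc D u v → u ∈ R ∩ in-nbhd v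
  ∈R∩in-nbhd⁺ u∈R uv = x∈p∩q⁺ (u∈R , ∈-tabulate⁺ uv)

  ∈R∩out-nbhd⁺ : ∀ {R u v} → u ∈ R → Arc D v u → u ∈ R ∩ out-nbhd v
  ∈R∩out-nbhd⁺ u∈R vu = x∈p∩q⁺ (u∈R , ∈-tabulate⁺ vu)

  ∈R∩in-nbhd⁻ : ∀ {R u v} → u ∈ R ∩ in-nbhd v → u ∈ R × Arc D u v
  ∈R∩in-nbhd⁻ {R} u∈ with x∈p∩q⁻ R _ u∈
  ... | u∈R , u∈N = u∈R , ∈-tabulate⁻ u∈N

  ∈R∩out-nbhd⁻ : ∀ {R u v} → u ∈ R ∩ out-nbhd v → u ∈ R × Arc D v u
  ∈R∩out-nbhd⁻ {R} u∈ with x∈p∩q⁻ R _ u∈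
  ... | u∈R , u∈N = u∈R , ∈-tabulate⁻ u∈N

  v∉R∩in-nbhd-v : ∀ {R v} → v ∉ R ∩ in-nbhd v
  v∉R∩in-nbhd-v v∈ = Arc⇒≢ (proj₂ (∈R∩in-nbhd⁻ v∈)) refl

  v∉R∩out-nbhd-v : ∀ {R v} → v ∉ R ∩ out-nbhd v
  v∉R∩out-nbhd-v v∈ = Arc⇒≢ (proj₂ (∈R∩out-nbhd⁻ v∈)) refl

  arc-path : ∀ {u v} → Arc D u v → DirPath D u v
  arc-path {u} {v} uv = record
    { nInt = 0 ; pth = lookup (u ∷ v ∷ []) ; inj = pair-injective (Arc⇒≢ uv)
    ; start = refl ; end = refl ; steps = λ { zero → uv } }

  digon : ∀ {u v} → Arc D u v → Arc D v u → DirCycle D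
  digon {u} {v} uv vu = record
    { len = 1 ; cyc = lookup (u ∷ v ∷ []) ; inj = pair-injective (Arc⇒≢ uv)
    ; steps = λ { zero → uv } ; close = vu }

record Embedding (F D : Digraph) : Set where
  field
    map           : Vtx F → Vtx D
    map-injective : Injective _≡_ _≡_ map
    map-arc       : ∀ {u v} → Arc F u v → Arc D (map u) (map v)

embedding⇒subdivision : ∀ {F D} → Embedding F D → ContainsSubdivision D F
embedding⇒subdivision {D = D} e = record
  { φ = map ; φ-inj = map-injective ; path = λ _ _ uv → arc-path D (map-arc uv)
  ; avoidφ = λ _ _ _ () ; disjoint = λ _ _ _ _ _ _ _ () }
  where open Embedding e

complete : ℕ → Digraph
complete c = record
  { size     = c
  ; arc      = λ u v → not (does (u ≟ v))
  ; loopless = λ v → cong not (dec-true (v ≟ v) refl) }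

complete-arc : ∀ {c} {u v : Fin c} → u ≢ v → Arc (complete c) u v
complete-arc {u = u} {v} u≢v = cong not (dec-false (u ≟ v) u≢v)

complete-dichromatic : ∀ c → DichromaticAtLeast (complete c) c
complete-dichromatic c k (f , acyclic) = ≮⇒≥ λ k<c →
  let i , j , i<j , fᵢ≡fⱼ = pigeonhole k<c f
      i≢j = <⇒≢ i<j
  in acyclic (f i) (digon (complete c) (complete-arc i≢j) (complete-arc (i≢j ∘ sym)))
             λ { zero → refl ; (suc zero) → sym fᵢ≡fⱼ }

forcing⇒size≤ : ∀ F c → ForcesSubdivision F c → size F ≤ c
forcing⇒size≤ F c forces =
  injective⇒≤ (ContainsSubdivision.φ-inj (forces (complete c) (complete-dichromatic c)))

module _ (D : Digraph) where

  DicolouringOn : ∀ {k} → Subset (size D) → (Vtx D → Fin k) → Set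
  DicolouringOn R f = ∀ (C : DirCycle D) → (∀ i → cyc C i ∈ R) → ∀ j → ¬ (∀ i → f (cyc C i) ≡ j)

  record MinSemiDegreeCore (m : ℕ) : Set where
    field
      R          : Subset (size D)
      root       : Vtx D
      root∈R     : root ∈ R
      in-degree  : ∀ {v} → v ∈ R → m ≤ ∣ R ∩ in-nbhd D v ∣
      out-degree : ∀ {v} → v ∈ R → m ≤ ∣ R ∩ out-nbhd D v ∣

  recolour : ∀ {k R v} (f : Vtx D → Fin k) (P : Subset (size D)) → ∣ P ∣ < k →
             DicolouringOn (R - v) f →
             (∀ C → (∀ i → cyc C i ∈ R) → ∀ {i} → cyc C i ≡ v → ∃ λ j → cyc C j ∈ P × cyc C j ≢ v) →
             Σ (Vtx D → Fin k) (DicolouringOn R)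
  recolour {k} {R} {v} f P ∣P∣<k proper cycles-meet-P
    with ∣p∣<∣q∣⇒∃∉image f P {⊤} (subst (∣ P ∣ <_) (sym (∣⊤∣≡n k)) ∣P∣<k)
  ... | c , _ , c∉f[P] = f′ , proper′
    where
    f′ : Vtx D → Fin k
    f′ = updateAt f v (λ _ → c)

    f′-other : ∀ {w} → w ≢ v → f′ w ≡ f w
    f′-other {w} w≢v = updateAt-minimal w v f w≢v

    proper′ : DicolouringOn R f′
    proper′ C C⊆R j f′C≡j with any? (λ i → cyc C i ≟ v)
    ... | no v∉C = proper C (λ i → x∈p∧x≢y⇒x∈p-y (C⊆R i) (v∉C ∘ (i ,_))) j
                     (λ i → trans (sym (f′-other (v∉C ∘ (i ,_)))) (f′C≡j i))
    ... | yes (i , Cᵢ≡v) with cycles-meet-P C C⊆R Cᵢ≡v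
    ...   | l , Cₗ∈P , Cₗ≢v = c∉f[P] Cₗ∈P (begin
      f (cyc C l)   ≡⟨ f′-other Cₗ≢v ⟨
      f′ (cyc C l)  ≡⟨ f′C≡j l ⟩
      j             ≡⟨ f′C≡j i ⟨
      f′ (cyc C i)  ≡⟨ cong f′ Cᵢ≡v ⟩
      f′ v          ≡⟨ updateAt-updates v f ⟩
      c             ∎)
      where open ≡-Reasoning

  cycles-meet-in-nbhd : ∀ {R v} C → (∀ i → cyc C i ∈ R) → ∀ {i} → cyc C i ≡ v →
                        ∃ λ j → cyc C j ∈ R ∩ in-nbhd D v × cyc C j ≢ v
  cycles-meet-in-nbhd C C⊆R {i} Cᵢ≡v with predecessor D C i
  ... | j , ji = j , ∈R∩in-nbhd⁺ D (C⊆R j) jv , Arc⇒≢ D jv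
    where jv = subst (Arc D (cyc C j)) Cᵢ≡v ji

  cycles-meet-out-nbhd : ∀ {R v} C → (∀ i → cyc C i ∈ R) → ∀ {i} → cyc C i ≡ v →
                         ∃ λ j → cyc C j ∈ R ∩ out-nbhd D v × cyc C j ≢ v
  cycles-meet-out-nbhd C C⊆R {i} Cᵢ≡v with successor D C i
  ... | j , ij = j , ∈R∩out-nbhd⁺ D (C⊆R j) vj , Arc⇒≢ D vj ∘ sym
    where vj = subst (λ u → Arc D u (cyc C j)) Cᵢ≡v ij

  core-or-colouring : ∀ {k} R → Acc _⊂_ R →
                      MinSemiDegreeCore (suc k) ⊎ Σ (Vtx D → Fin (suc k)) (DicolouringOn R)
  core-or-colouring {k} R (acc smaller)
    with any? (λ v → v ∈? R ×-dec (∣ R ∩ in-nbhd D v ∣ <? suc k ⊎-dec ∣ R ∩ out-nbhd D v ∣ <? suc k))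
  ... | yes (v , v∈R , low) with core-or-colouring (R - v) (smaller (x∈p⇒p-x⊂p v∈R)) | low
  ...   | inj₁ core       | _           = inj₁ core
  ...   | inj₂ (f , prop) | inj₁ low-in  = inj₂ (recolour f _ low-in prop cycles-meet-in-nbhd)
  ...   | inj₂ (f , prop) | inj₂ low-out = inj₂ (recolour f _ low-out prop cycles-meet-out-nbhd)
  core-or-colouring R _ | no none-low with nonempty? R
  ... | yes (r , r∈R) = inj₁ (record
        { R = R ; root = r ; root∈R = r∈R
        ; in-degree  = λ {v} v∈R → ≮⇒≥ (λ low → none-low (v , v∈R , inj₁ low))
        ; out-degree = λ {v} v∈R → ≮⇒≥ (λ low → none-low (v , v∈R , inj₂ low)) })
  ... | no empty = inj₂ ((λ _ → zero) , λ C C⊆R _ _ → empty (cyc C zero , C⊆R zero))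

  core-or-dicolourable : ∀ m → MinSemiDegreeCore m ⊎ Dicolourable D m
  core-or-dicolourable zero with nonempty? (⊤ {size D})
  ... | yes (r , _) = inj₁ (record
        { R = ⊤ ; root = r ; root∈R = ∈⊤ ; in-degree = λ _ → z≤n ; out-degree = λ _ → z≤n })
  ... | no empty    = inj₂ ((λ v → contradiction (v , ∈⊤) empty) , λ ())
  core-or-dicolourable (suc k) with core-or-colouring ⊤ (⊂-wellFounded ⊤)
  ... | inj₁ core       = inj₁ core
  ... | inj₂ (f , prop) = inj₂ (f , λ j C f[C]≡j → prop C (λ _ → ∈⊤) j f[C]≡j)

  dichromatic⇒core : ∀ {m} → DichromaticAtLeast D (suc m) → MinSemiDegreeCore m
  dichromatic⇒core {m} χ≥1+m with core-or-dicolourable m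
  ... | inj₁ core        = core
  ... | inj₂ colourable = contradiction (χ≥1+m m colourable) 1+n≰n

  core-size : ∀ {m} (K : MinSemiDegreeCore m) → m < ∣ MinSemiDegreeCore.R K ∣
  core-size K = ≤-<-trans (out-degree root∈R)
                  (p⊂q⇒∣p∣<∣q∣ (p∩q⊆p R _ , root , root∈R , v∉R∩out-nbhd-v D))
    where open MinSemiDegreeCore K

record UndirPath (D : Digraph) (k : ℕ) : Set where
  field
    vtx           : Fin (suc k) → Vtx D
    vtx-injective : Injective _≡_ _≡_ vtx
    adjacent      : ∀ (i : Fin k) → UAdj D (vtx (inject₁ i)) (vtx (suc i))

open UndirPath

inject₁-inject≤ : ∀ {k l} (i : Fin k) .(k≤l : k ≤ l) .(1+k≤1+l : suc k ≤ suc l) →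
                  inject₁ (inject≤ i k≤l) ≡ inject≤ (inject₁ i) 1+k≤1+l
inject₁-inject≤ i _ _ = toℕ-injective (begin
  toℕ (inject₁ (inject≤ i _))  ≡⟨ toℕ-inject₁ _ ⟩
  toℕ (inject≤ i _)            ≡⟨ toℕ-inject≤ i _ ⟩
  toℕ i                        ≡⟨ toℕ-inject₁ i ⟨
  toℕ (inject₁ i)              ≡⟨ toℕ-inject≤ (inject₁ i) _ ⟨
  toℕ (inject≤ (inject₁ i) _)  ∎)
  where open ≡-Reasoning

inject≤-fromℕ-toℕ : ∀ {k} (t : Fin k) .(1+t≤k : suc (toℕ t) ≤ k) →
                    inject≤ (fromℕ (toℕ t)) 1+t≤k ≡ t
inject≤-fromℕ-toℕ t _ =
  toℕ-injective (trans (toℕ-inject≤ (fromℕ (toℕ t)) _) (toℕ-fromℕ (toℕ t)))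

module _ (D : Digraph) where

  prefix : ∀ {k} (P : UndirPath D k) (t : Fin (suc k)) → UndirPath D (toℕ t)
  prefix P t = record
    { vtx           = λ i → vtx P (inject≤ i (toℕ<n t))
    ; vtx-injective = λ eq → inject≤-injective _ _ _ _ (vtx-injective P eq)
    ; adjacent      = λ i → subst (λ j → UAdj D (vtx P j) (vtx P (inject≤ (suc i) (toℕ<n t))))
                                  (inject₁-inject≤ i _ (toℕ<n t))
                                  (adjacent P (inject≤ i (s≤s⁻¹ (toℕ<n t)))) }

  prefix-last : ∀ {k} (P : UndirPath D k) t → vtx (prefix P t) (fromℕ (toℕ t)) ≡ vtx P t
  prefix-last P t = cong (vtx P) (inject≤-fromℕ-toℕ t (toℕ<n t))

  close-path : ∀ {l} (P : UndirPath D (suc (suc l))) → UAdj D (vtx P (fromℕ _)) (vtx P zero) →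
               UndirCycle D
  close-path P closing = record
    { len = _ ; cyc = vtx P ; inj = vtx-injective P ; steps = adjacent P ; close = closing }

  extend : ∀ {k} (P : UndirPath D k) {x} → UAdj D x (vtx P zero) → (∀ t → vtx P t ≢ x) →
           UndirPath D (suc k)
  extend P {x} x~P₀ fresh = record
    { vtx           = x Vector.∷ vtx P
    ; vtx-injective = injective
    ; adjacent      = λ { zero → x~P₀ ; (suc i) → adjacent P i } }
    where
    injective : Injective _≡_ _≡_ (x Vector.∷ vtx P)
    injective {zero}  {zero}  _     = refl
    injective {zero}  {suc j} x≡Pⱼ  = contradiction (sym x≡Pⱼ) (fresh j)
    injective {suc i} {zero}  Pᵢ≡x  = contradiction Pᵢ≡x (fresh i)
    injective {suc i} {suc j} Pᵢ≡Pⱼ = cong suc (vtx-injective P Pᵢ≡Pⱼ)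

  IsLeafIn : Subset (size D) → Vtx D → Set
  IsLeafIn S v = ∀ {a b} → a ∈ S → b ∈ S → UAdj D v a → UAdj D v b → a ≡ b

  Branches : Subset (size D) → Vtx D → Set
  Branches S v = ∃₂ λ a b → a ∈ S × b ∈ S × UAdj D v a × UAdj D v b × a ≢ b

  leaf-or-branches : ∀ S v → IsLeafIn S v ⊎ Branches S v
  leaf-or-branches S v
    with any? (λ a → any? (λ b →
           a ∈? S ×-dec b ∈? S ×-dec UAdj? D v a ×-dec UAdj? D v b ×-dec ¬? (a ≟ b)))
  ... | yes branches  = inj₂ branches
  ... | no ¬branches = inj₁ λ {a} {b} a∈S b∈S v~a v~b →
        decidable-stable (a ≟ b) (λ a≢b → ¬branches (a , b , a∈S , b∈S , v~a , v~b , a≢b))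

-- The vertex after the head of a path; for a one-vertex path, the head itself.
second : ∀ {k} → Fin (suc k)
second {zero}  = zero
second {suc k} = suc zero

module _ (F : OrientedForest) where
  private
    G = graph F

  ¬digon : ∀ {u v} → Arc G u v → ¬ Arc G v u
  ¬digon {u} {v} uv vu with trans (sym vu) (noDigon F u v uv)
  ... | ()

  fresh-neighbour : ∀ {k} (P : UndirPath G k) {x} → UAdj G (vtx P zero) x → x ≢ vtx P second →
                    ∀ t → vtx P t ≢ x
  fresh-neighbour P P₀~x x≢P₁ zero          P₀≡x = UAdj-irrefl G (subst (UAdj G _) (sym P₀≡x) P₀~x)
  fresh-neighbour P P₀~x x≢P₁ (suc zero)    P₁≡x = x≢P₁ (sym P₁≡x)
  fresh-neighbour P P₀~x x≢P₁ (suc (suc t)) Pₜ≡x =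
    acyclicU F (close-path G (prefix G P (suc (suc t))) chord)
    where
    chord = subst (λ y → UAdj G y (vtx P zero))
                  (sym (trans (prefix-last G P (suc (suc t))) Pₜ≡x)) (UAdj-sym G P₀~x)

  extend-at-branch : ∀ {S k} (P : UndirPath G k) → (∀ i → vtx P i ∈ S) → Branches G S (vtx P zero) →
                     Σ (UndirPath G (suc k)) λ P′ → ∀ i → vtx P′ i ∈ S
  extend-at-branch P P⊆S (a , b , a∈S , b∈S , P₀~a , P₀~b , a≢b) with a ≟ vtx P second
  ... | no  a≢P₁ = extend G P (UAdj-sym G P₀~a) (fresh-neighbour P P₀~a a≢P₁) ,
                   λ { zero → a∈S ; (suc i) → P⊆S i }
  ... | yes a≡P₁ = extend G P (UAdj-sym G P₀~b) (fresh-neighbour P P₀~b b≢P₁) ,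
                   λ { zero → b∈S ; (suc i) → P⊆S i }
    where b≢P₁ = λ b≡P₁ → a≢b (trans a≡P₁ (sym b≡P₁))

  -- A path has at most size G vertices, so fuel bounds how often it can still grow.
  walk-to-leaf : ∀ {S} fuel {k} (P : UndirPath G k) → (∀ i → vtx P i ∈ S) → size G ≤ k + fuel →
                 ∃ λ ℓ → ℓ ∈ S × IsLeafIn G S ℓ
  walk-to-leaf zero {k} P _ n≤k+0 =
    contradiction (subst (size G ≤_) (+-identityʳ k) n≤k+0) (<⇒≱ (injective⇒≤ (vtx-injective P)))
  walk-to-leaf {S} (suc fuel) {k} P P⊆S n≤k+1+fuel with leaf-or-branches G S (vtx P zero)
  ... | inj₁ leaf     = vtx P zero , P⊆S zero , leaf
  ... | inj₂ branches with extend-at-branch P P⊆S branches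
  ...   | P′ , P′⊆S = walk-to-leaf fuel P′ P′⊆S (subst (size G ≤_) (+-suc k fuel) n≤k+1+fuel)

  leaf-exists : ∀ {S s} → s ∈ S → ∃ λ ℓ → ℓ ∈ S × IsLeafIn G S ℓ
  leaf-exists {s = s} s∈S = walk-to-leaf (size G) point (λ _ → s∈S) ≤-refl
    where
    point : UndirPath G 0
    point = record
      { vtx = λ _ → s ; vtx-injective = λ { {zero} {zero} _ → refl } ; adjacent = λ () }

module _ (F : OrientedForest) {D : Digraph} {m} (K : MinSemiDegreeCore D m) where
  private
    G = graph F
  open MinSemiDegreeCore K

  record EmbeddingOn (S : Subset (size G)) : Set where
    field
      map         : Vtx G → Vtx D
      map∈R       : ∀ {w} → w ∈ S → map w ∈ R
      injectiveOn : ∀ {a b} → a ∈ S → b ∈ S → map a ≡ map b → a ≡ b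
      arcOn       : ∀ {a b} → a ∈ S → b ∈ S → Arc G a b → Arc D (map a) (map b)

  open EmbeddingOn

  extend-embedding : ∀ {S ℓ} (E : EmbeddingOn (S - ℓ)) {x} → x ∈ R →
                     (∀ {w} → w ∈ S - ℓ → map E w ≢ x) →
                     (∀ {u} → u ∈ S - ℓ → Arc G u ℓ → Arc D (map E u) x) →
                     (∀ {u} → u ∈ S - ℓ → Arc G ℓ u → Arc D x (map E u)) →
                     EmbeddingOn S
  extend-embedding {S} {ℓ} E {x} x∈R x-fresh into-x out-of-x = record
    { map = map′ ; map∈R = map′∈R ; injectiveOn = injectiveOn′ ; arcOn = arcOn′ }
    where
    map′ : Vtx G → Vtx D
    map′ = updateAt (map E) ℓ (λ _ → x)

    map′-ℓ : map′ ℓ ≡ x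
    map′-ℓ = updateAt-updates ℓ (map E)

    split : ∀ {w} → w ∈ S → w ≡ ℓ ⊎ (w ∈ S - ℓ × map′ w ≡ map E w)
    split {w} w∈S with w ≟ ℓ
    ... | yes w≡ℓ = inj₁ w≡ℓ
    ... | no  w≢ℓ = inj₂ (x∈p∧x≢y⇒x∈p-y w∈S w≢ℓ , updateAt-minimal w ℓ (map E) w≢ℓ)

    map′∈R : ∀ {w} → w ∈ S → map′ w ∈ R
    map′∈R w∈S with split w∈S
    ... | inj₁ refl        = subst (_∈ R) (sym map′-ℓ) x∈R
    ... | inj₂ (w∈ , w↦) = subst (_∈ R) (sym w↦) (map∈R E w∈)

    injectiveOn′ : ∀ {a b} → a ∈ S → b ∈ S → map′ a ≡ map′ b → a ≡ b
    injectiveOn′ a∈S b∈S a≡b with split a∈S | split b∈S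
    ... | inj₁ refl        | inj₁ refl        = refl
    ... | inj₁ refl        | inj₂ (b∈ , b↦) =
          contradiction (trans (sym b↦) (trans (sym a≡b) map′-ℓ)) (x-fresh b∈)
    ... | inj₂ (a∈ , a↦) | inj₁ refl        =
          contradiction (trans (sym a↦) (trans a≡b map′-ℓ)) (x-fresh a∈)
    ... | inj₂ (a∈ , a↦) | inj₂ (b∈ , b↦) = injectiveOn E a∈ b∈ (trans (sym a↦) (trans a≡b b↦))

    arcOn′ : ∀ {a b} → a ∈ S → b ∈ S → Arc G a b → Arc D (map′ a) (map′ b)
    arcOn′ a∈S b∈S ab with split a∈S | split b∈S
    ... | inj₁ refl        | inj₁ refl        = contradiction refl (Arc⇒≢ G ab)
    ... | inj₁ refl        | inj₂ (b∈ , b↦) = subst₂ (Arc D) (sym map′-ℓ) (sym b↦) (out-of-x b∈ ab)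
    ... | inj₂ (a∈ , a↦) | inj₁ refl        = subst₂ (Arc D) (sym a↦) (sym map′-ℓ) (into-x a∈ ab)
    ... | inj₂ (a∈ , a↦) | inj₂ (b∈ , b↦) = subst₂ (Arc D) (sym a↦) (sym b↦) (arcOn E a∈ b∈ ab)

  -- Since the image of u is not a candidate, only the fewer than m vertices of S - ℓ - u
  -- compete for the m candidates in Q.
  fresh-vertex-in : ∀ {S ℓ u} (E : EmbeddingOn (S - ℓ)) → ∣ S ∣ ≤ suc m → ℓ ∈ S → u ∈ S - ℓ →
                    ∀ Q → m ≤ ∣ Q ∣ → map E u ∉ Q →
                    ∃ λ x → x ∈ Q × ∀ {w} → w ∈ S - ℓ → map E w ≢ x
  fresh-vertex-in {S} {ℓ} {u} E ∣S∣≤1+m ℓ∈S u∈S-ℓ Q m≤∣Q∣ u↦∉Q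
    with ∣p∣<∣q∣⇒∃∉image (map E) (S - ℓ - u) {Q} ∣S-ℓ-u∣<∣Q∣
    where
    ∣S-ℓ∣≤m     = s≤s⁻¹ (<-≤-trans (x∈p⇒∣p-x∣<∣p∣ ℓ∈S) ∣S∣≤1+m)
    ∣S-ℓ-u∣<∣Q∣ = <-≤-trans (<-≤-trans (x∈p⇒∣p-x∣<∣p∣ u∈S-ℓ) ∣S-ℓ∣≤m) m≤∣Q∣
  ... | x , x∈Q , x-fresh = x , x∈Q , fresh
    where
    fresh : ∀ {w} → w ∈ S - ℓ → map E w ≢ x
    fresh {w} w∈S-ℓ with w ≟ u
    ... | yes refl = λ u↦≡x → u↦∉Q (subst (_∈ Q) (sym u↦≡x) x∈Q)
    ... | no  w≢u  = x-fresh (x∈p∧x≢y⇒x∈p-y w∈S-ℓ w≢u)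

  place-leaf : ∀ {S ℓ} → ∣ S ∣ ≤ suc m → ℓ ∈ S → IsLeafIn G S ℓ → EmbeddingOn (S - ℓ) →
               EmbeddingOn S
  place-leaf {S} {ℓ} ∣S∣≤1+m ℓ∈S leaf E with any? (λ u → u ∈? S - ℓ ×-dec UAdj? G ℓ u)
  ... | no isolated with ∣p∣<∣q∣⇒∃∉image (map E) (S - ℓ) {R}
                          (<-≤-trans (x∈p⇒∣p-x∣<∣p∣ ℓ∈S) (≤-trans ∣S∣≤1+m (core-size D K)))
  ...   | x , x∈R , x-fresh = extend-embedding E x∈R x-fresh
            (λ u∈ uℓ → contradiction (_ , u∈ , UAdj-sym G (Arc⇒UAdj G uℓ)) isolated)
            (λ u∈ ℓu → contradiction (_ , u∈ , Arc⇒UAdj G ℓu) isolated)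
  place-leaf {S} {ℓ} ∣S∣≤1+m ℓ∈S leaf E | yes (u , u∈S-ℓ , ℓ~u) = attach (UAdj⇒Arc⊎Arc˘ G ℓ~u)
    where
    from-ℓ : ∀ {w} → w ∈ S - ℓ → UAdj G ℓ w → w ≡ u
    from-ℓ w∈ ℓ~w = leaf (p─q⊆p S _ w∈) (p─q⊆p S _ u∈S-ℓ) ℓ~w ℓ~u

    Arc⇒UAdj˘ : ∀ {w} → Arc G w ℓ → UAdj G ℓ w
    Arc⇒UAdj˘ wℓ = UAdj-sym G (Arc⇒UAdj G wℓ)

    attach : Arc G ℓ u ⊎ Arc G u ℓ → EmbeddingOn S
    attach (inj₁ ℓu)
      with fresh-vertex-in E ∣S∣≤1+m ℓ∈S u∈S-ℓ _ (in-degree (map∈R E u∈S-ℓ)) (v∉R∩in-nbhd-v D)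
    ... | x , x∈ , x-fresh with ∈R∩in-nbhd⁻ D x∈
    ...   | x∈R , x↦u = extend-embedding E x∈R x-fresh
            (λ w∈ wℓ → ⊥-elim (¬digon F ℓu (subst (λ w → Arc G w ℓ) (from-ℓ w∈ (Arc⇒UAdj˘ wℓ)) wℓ)))
            (λ w∈ ℓw → subst (λ w → Arc D x (map E w)) (sym (from-ℓ w∈ (Arc⇒UAdj G ℓw))) x↦u)
    attach (inj₂ uℓ)
      with fresh-vertex-in E ∣S∣≤1+m ℓ∈S u∈S-ℓ _ (out-degree (map∈R E u∈S-ℓ)) (v∉R∩out-nbhd-v D)
    ... | x , x∈ , x-fresh with ∈R∩out-nbhd⁻ D x∈
    ...   | x∈R , u↦x = extend-embedding E x∈R x-fresh
            (λ w∈ wℓ → subst (λ w → Arc D (map E w) x) (sym (from-ℓ w∈ (Arc⇒UAdj˘ wℓ))) u↦x)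
            (λ w∈ ℓw → ⊥-elim (¬digon F uℓ (subst (Arc G ℓ) (from-ℓ w∈ (Arc⇒UAdj G ℓw)) ℓw)))

  embed-subset : ∀ S → Acc _⊂_ S → ∣ S ∣ ≤ suc m → EmbeddingOn S
  embed-subset S (acc smaller) ∣S∣≤1+m with nonempty? S
  ... | no empty = record
        { map = λ _ → root ; map∈R = λ w∈S → contradiction (_ , w∈S) empty
        ; injectiveOn = λ a∈S → contradiction (_ , a∈S) empty
        ; arcOn = λ a∈S → contradiction (_ , a∈S) empty }
  ... | yes (s , s∈S) with leaf-exists F s∈S
  ...   | ℓ , ℓ∈S , leaf = place-leaf ∣S∣≤1+m ℓ∈S leaf
            (embed-subset (S - ℓ) (smaller (x∈p⇒p-x⊂p ℓ∈S)) (≤-trans (∣p─q∣≤∣p∣ S _) ∣S∣≤1+m))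

  core-embedding : size G ≤ suc m → Embedding G D
  core-embedding n≤1+m = record
    { map = map E ; map-injective = injectiveOn E ∈⊤ ∈⊤ ; map-arc = arcOn E ∈⊤ ∈⊤ }
    where E = embed-subset ⊤ (⊂-wellFounded ⊤) (subst (_≤ suc m) (sym (∣⊤∣≡n _)) n≤1+m)

empty-embedding : ∀ {F D} → size F ≤ 0 → Embedding F D
empty-embedding {F} F≤0 = record
  { map = λ v → absurd v ; map-injective = λ {v} _ → absurd v ; map-arc = λ {u} _ → absurd u }
  where
  absurd : ∀ {A : Set} → Vtx F → A
  absurd v = ⊥-elim (¬Fin0 (inject≤ v F≤0))

dichromatic⇒embedding : ∀ (F : OrientedForest) {D} m → size (graph F) ≤ m →
                        DichromaticAtLeast D m → Embedding (graph F) D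
dichromatic⇒embedding F zero    F≤0   _      = empty-embedding F≤0
dichromatic⇒embedding F (suc m) F≤1+m χ≥1+m = core-embedding F (dichromatic⇒core _ χ≥1+m) F≤1+m

corollary35 : (F : OrientedForest) → MadChi≡ (graph F) (size (graph F))
corollary35 F =
  (λ D χ≥n → embedding⇒subdivision (dichromatic⇒embedding F (size (graph F)) ≤-refl χ≥n)) ,
  forcing⇒size≤ (graph F)
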